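{- Let $m\ge0$ be an integer and let $s_n$ be defined by $s_n=\delta_{n,0}+s_{n-1}+s_{n-m-2}$ for $n\ge0$ and $s_n=0$ for $n<0$. Then for all $n\ge0$, \[ s_n^2=\delta_{n,0}+s_{n-1}^2+s_{n-m-2}^2+2\sum_{l=m+2}^nP_{l-1}^{\{ -2,-1,m\}}s_{n-l}^2. \]
   Context: $\delta_{i,j}$ is $1$ if $i=j$ and $0$ otherwise. For a finite set $W$ of integers, $P_n^W$ is the number of permutations $\pi$ of $\{1,\ldots,n\}$ with $\pi(i)-i\in W$ for all $i$ (equivalently, the permanent of the $n\times n$ $(0,1)$ matrix whose $(i,j)$ entry is $1$ iff $j-i\in W$), with $P_0^W=1$. -}

module Defs where

open import Data.Nat using (ℕ; zero; suc; _∸_) renaming (_+_ to _+ℕ_)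
open import Data.Integer using (ℤ; +_; _-_; _+_; _*_; -[1+_])
open import Data.Integer.Properties using () renaming (_≟_ to _≟ℤ_)
open import Data.Fin using (Fin; toℕ)
open import Data.Fin.Properties using () renaming (_≟_ to _≟F_)
open import Data.Vec using (Vec; []; _∷_; lookup)
open import Data.List using (List; []; _∷_; map; concatMap; filter; length; foldr; upTo; allFin)
open import Data.Bool using (Bool; true; false; _∧_; _∨_; not; T)
open import Relation.Nullary using (does)
open import Relation.Nullary.Decidable using (T?)

δ : ℕ → ℕ → ℤ
δ i j with does (Data.Nat._≟_ i j)
... | true  = + 1
... | false = + 0

allVecs : (k n : ℕ) → List (Vec (Fin n) k)
allVecs zero    n = [] ∷ []
allVecs (suc k) n = concatMap (λ x → map (x ∷_) (allVecs k n)) (allFin n)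

_∈ᵇ_ : ℤ → List ℤ → Bool
x ∈ᵇ []       = false
x ∈ᵇ (w ∷ ws) = does (x ≟ℤ w) ∨ (x ∈ᵇ ws)

notIn : ∀ {n k} → Fin n → Vec (Fin n) k → Bool
notIn x []       = true
notIn x (y ∷ ys) = not (does (x ≟F y)) ∧ notIn x ys

distinct : ∀ {n k} → Vec (Fin n) k → Bool
distinct []       = true
distinct (x ∷ xs) = notIn x xs ∧ distinct xs

-- π(i) - i ∈ W for every i (indices 0-based; the difference is shift-invariant)
allowed : ∀ {n} → List ℤ → Vec (Fin n) n → Bool
allowed {n} W π = foldr (λ i b → ((+ toℕ (lookup π i)) - (+ toℕ i)) ∈ᵇ W ∧ b) true (allFin n)

-- A permutation of {1..n} is represented by the vector (π(1),…,π(n)) with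
-- pairwise distinct entries (an injective self-map of a finite set).
P : ℕ → List ℤ → ℕ
P n W = length (filter (λ π → T? (distinct π ∧ allowed W π)) (allVecs n n))

-- Σ_{l=a}^{b} f l  (empty sum = 0 when a > b)
sumFromTo : ℕ → ℕ → (ℕ → ℤ) → ℤ
sumFromTo a b f = foldr (λ i acc → f (a +ℕ i) + acc) (+ 0) (upTo (suc b ∸ a))

_⊖ℕ_ : ℕ → ℕ → ℤ
n ⊖ℕ k = (+ n) - (+ k)

-- Write t n = s (+ n). One step of the recurrence turns the identity into a statement about the
-- cross term: t (R + m + 1) · t R = Σ_{i ≤ R} P_{m+1+i} · t (R − i)². This is the case d = m + 1 of
-- t (R + d) · t R = (w_d ⋆ t²) R  (0 ≤ d ≤ m + 1), which holds for every family of sequences with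
-- w_0 = δ and w_{d+1} = w_d + x^{m+1−d} w_{m+1−d} (as generating functions): expanding t (R + d + 1)
-- by the recurrence splits off t (R − (m + 1 − d)) · t R, a shorter instance of the same identity.
--
-- Such a family is obtained by building the permutation position by position. At position o the
-- admissible values o − 2, o − 1, o + m are the slots 0, 1, m + 2 of a window that moves one step
-- per position. Let w_{d+1} j count the completions of length d + j from a window whose slots 0
-- and d + 1 are taken. The recursion for w is the case split on the first move, together with the
-- fact that a free slot 0 has to be filled at once: it leaves the window afterwards, and counting
-- free slots shows that no completion is possible then. Finally w_1 j = P_j, so that
-- w_{m+1} i = P_{m+1+i}.
module Submission where

open import Defs
open import Data.Bool using (Bool; true; false; not; _∧_; _∨_; if_then_else_; T)
open import Data.Nat using (ℕ; zero; suc; _∸_; _≡ᵇ_; _<ᵇ_; z≤n; s≤s)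
import Data.Nat.Properties as ℕ
open import Algebra.Structures using (IsCommutativeMonoid)
open import Relation.Binary.PropositionalEquality

module RangeSums {A : Set} {_∙_ : A → A → A} {ε : A}
                 (isCommutativeMonoid : IsCommutativeMonoid _≡_ _∙_ ε) where

  open IsCommutativeMonoid isCommutativeMonoid using (identityˡ; identityʳ; isCommutativeSemigroup)
  open import Algebra.Bundles using (CommutativeSemigroup)
  open import Data.Nat using (_+_; _<_)
  open import Level using (0ℓ)

  commutativeSemigroup : CommutativeSemigroup 0ℓ 0ℓ
  commutativeSemigroup = record { isCommutativeSemigroup = isCommutativeSemigroup }

  open import Algebra.Properties.CommutativeSemigroup commutativeSemigroup using (interchange)

  ∑< : ℕ → (ℕ → A) → A
  ∑< zero    f = ε
  ∑< (suc n) f = f 0 ∙ ∑< n (λ i → f (suc i))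

  ∑<-cong : ∀ n {f g : ℕ → A} → (∀ i → i < n → f i ≡ g i) → ∑< n f ≡ ∑< n g
  ∑<-cong zero    f≗g = refl
  ∑<-cong (suc n) f≗g = cong₂ _∙_ (f≗g 0 (s≤s z≤n)) (∑<-cong n (λ i i<n → f≗g (suc i) (s≤s i<n)))

  ∑<-zero : ∀ n {f : ℕ → A} → (∀ i → i < n → f i ≡ ε) → ∑< n f ≡ ε
  ∑<-zero zero    f≗ε = refl
  ∑<-zero (suc n) f≗ε =
    trans (cong₂ _∙_ (f≗ε 0 (s≤s z≤n)) (∑<-zero n (λ i i<n → f≗ε (suc i) (s≤s i<n)))) (identityˡ ε)

  ∑<-distrib : ∀ n (f g : ℕ → A) → ∑< n (λ i → f i ∙ g i) ≡ ∑< n f ∙ ∑< n g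
  ∑<-distrib zero    f g = sym (identityˡ ε)
  ∑<-distrib (suc n) f g = trans (cong ((f 0 ∙ g 0) ∙_) (∑<-distrib n _ _)) (interchange _ _ _ _)

  ∑<-leadingZeros : ∀ a n {f : ℕ → A} → (∀ i → i < a → f i ≡ ε) →
                    ∑< (a + n) f ≡ ∑< n (λ i → f (a + i))
  ∑<-leadingZeros zero    n f≗ε = refl
  ∑<-leadingZeros (suc a) n {f} f≗ε =
    trans (cong (_∙ ∑< (a + n) (λ i → f (suc i))) (f≗ε 0 (s≤s z≤n)))
          (trans (identityˡ _) (∑<-leadingZeros a n (λ i i<a → f≗ε (suc i) (s≤s i<a))))

  ∑<-point : ∀ n c (g : ℕ → A) →
             ∑< n (λ x → if x ≡ᵇ c then g x else ε) ≡ (if c <ᵇ n then g c else ε)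
  ∑<-point zero    c       g = refl
  ∑<-point (suc n) zero    g = trans (cong (g 0 ∙_) (∑<-zero n (λ _ _ → refl))) (identityʳ (g 0))
  ∑<-point (suc n) (suc c) g = trans (cong (ε ∙_) (∑<-point n c (λ x → g (suc x)))) (identityˡ _)

module Counting where

  open import Data.Fin using (toℕ)
  open import Data.List using (List; []; _∷_; _++_; map; concatMap; filterᵇ; length; tabulate)
  import Data.List.Properties as List
  open import Data.Nat using (_+_)
  open import Data.Nat.ListAction using (sum)
  open import Relation.Nullary.Decidable using (T?)
  open RangeSums ℕ.+-0-isCommutativeMonoid using (∑<)

  count : {A : Set} → (A → Bool) → List A → ℕ
  count p xs = length (filterᵇ p xs)

  count-cong : ∀ {A : Set} {p q : A → Bool} → (∀ x → p x ≡ q x) → ∀ xs → count p xs ≡ count q xs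
  count-cong p≗q []       = refl
  count-cong {p = p} {q} p≗q (x ∷ xs) with p x | q x | p≗q x
  ... | true  | true  | refl = cong suc (count-cong p≗q xs)
  ... | false | false | refl = count-cong p≗q xs

  count-++ : ∀ {A : Set} (p : A → Bool) xs ys → count p (xs ++ ys) ≡ count p xs + count p ys
  count-++ p xs ys = trans (cong length (List.filter-++ (λ x → T? (p x)) xs ys)) (List.length-++ (filterᵇ p xs))

  count-concatMap : ∀ {A B : Set} (p : B → Bool) (g : A → List B) xs →
                    count p (concatMap g xs) ≡ sum (map (λ x → count p (g x)) xs)
  count-concatMap p g []       = refl
  count-concatMap p g (x ∷ xs) =
    trans (count-++ p (g x) (concatMap g xs)) (cong (count p (g x) +_) (count-concatMap p g xs))

  count-map : ∀ {A B : Set} (p : B → Bool) (f : A → B) xs → count p (map f xs) ≡ count (λ x → p (f x)) xs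
  count-map p f []       = refl
  count-map p f (x ∷ xs) with p (f x)
  ... | true  = cong suc (count-map p f xs)
  ... | false = count-map p f xs

  count-guard : ∀ {A : Set} b (q : A → Bool) xs → count (λ x → b ∧ q x) xs ≡ (if b then count q xs else 0)
  count-guard true  q xs       = refl
  count-guard false q []       = refl
  count-guard false q (x ∷ xs) = count-guard false q xs

  sum-tabulate : ∀ n (h : ℕ → ℕ) → sum (tabulate {n = n} (λ i → h (toℕ i))) ≡ ∑< n h
  sum-tabulate zero    h = refl
  sum-tabulate (suc n) h = cong (h 0 +_) (sum-tabulate n (λ i → h (suc i)))

-- At position o of a permutation, slot y of the window stands for the value o − 2 + y.
module Windows where

  open import Data.Bool.Properties using (∨-identityʳ)
  open import Data.Nat using (_+_; _≤_; _<_)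
  open import Relation.Nullary using (contradiction)

  <ᵇ-true : ∀ {m n} → m < n → (m <ᵇ n) ≡ true
  <ᵇ-true (s≤s z≤n)       = refl
  <ᵇ-true (s≤s (s≤s m<n)) = <ᵇ-true (s≤s m<n)

  <ᵇ-false : ∀ {m n} → n ≤ m → (m <ᵇ n) ≡ false
  <ᵇ-false z≤n       = refl
  <ᵇ-false (s≤s n≤m) = <ᵇ-false n≤m

  ≡ᵇ-false : ∀ {m n} → m ≢ n → (m ≡ᵇ n) ≡ false
  ≡ᵇ-false {zero}  {zero}  m≢n = contradiction refl m≢n
  ≡ᵇ-false {zero}  {suc n} m≢n = refl
  ≡ᵇ-false {suc m} {zero}  m≢n = refl
  ≡ᵇ-false {suc m} {suc n} m≢n = ≡ᵇ-false (λ m≡n → m≢n (cong suc m≡n))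

  Window : Set
  Window = ℕ → Bool

  empty : Window
  empty _ = false

  occupy : ℕ → Window → Window
  occupy y U z = (y ≡ᵇ z) ∨ U z

  advance : Window → ℕ → Window
  advance U y z = occupy y U (suc z)

  blocked : ℕ → ℕ → Window
  blocked a b = occupy a (occupy b empty)

  blocked-comm : ∀ a b z → blocked a b z ≡ blocked b a z
  blocked-comm a b z with a ≡ᵇ z | b ≡ᵇ z
  ... | true  | true  = refl
  ... | true  | false = refl
  ... | false | true  = refl
  ... | false | false = refl

  free : ℕ → Window → ℕ
  free zero    U = 0
  free (suc K) U = (if U 0 then 0 else 1) + free K (λ z → U (suc z))

  free-empty : ∀ K → free K empty ≡ K
  free-empty zero    = refl
  free-empty (suc K) = cong suc (free-empty K)

  free-occupy : ∀ K {U y} → U y ≡ false → y < K → suc (free K (occupy y U)) ≡ free K U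
  free-occupy (suc K) {U} {zero}  Uy≡false _ rewrite Uy≡false = refl
  free-occupy (suc K) {U} {suc y} Uy≡false (s≤s y<K) =
    trans (sym (ℕ.+-suc (if U 0 then 0 else 1) _))
          (cong ((if U 0 then 0 else 1) +_) (free-occupy K Uy≡false y<K))

  free-blocked : ∀ K {a b} → a ≢ b → a < K → b < K → suc (suc (free K (blocked a b))) ≡ K
  free-blocked K {a} {b} a≢b a<K b<K = begin
    suc (suc (free K (blocked a b))) ≡⟨ cong suc (free-occupy K b≢a a<K) ⟩
    suc (free K (occupy b empty))    ≡⟨ free-occupy K refl b<K ⟩
    free K empty                     ≡⟨ free-empty K ⟩
    K                                ∎
    where
    open ≡-Reasoning
    b≢a : occupy b empty a ≡ false
    b≢a = trans (∨-identityʳ _) (≡ᵇ-false (λ b≡a → a≢b (sym b≡a)))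

  free-advance : ∀ K {U y} → U y ≡ false → y < suc K → free K (advance U y) < free (suc K) U
  free-advance K {U} {zero}  U0≡false _ rewrite U0≡false = ℕ.≤-refl
  free-advance K {U} {suc y} Uy≡false (s≤s y<K) =
    ℕ.≤-trans (ℕ.≤-reflexive (free-occupy K Uy≡false y<K)) (ℕ.m≤n+m _ (if U 0 then 0 else 1))

module Fillings (m : ℕ) where

  open Windows
  open import Data.Bool.Properties using (∨-identityʳ)
  open import Data.Nat using (_+_; _≤_; _<_)
  open import Function using (_∘_)

  move : (Window → ℕ) → ℕ → Window → ℕ → ℕ
  move rest K U y = if y <ᵇ K then (if U y then 0 else rest (advance U y)) else 0

  -- fillings k U counts the ways to fill k remaining positions. With k + 1 positions left, the
  -- values below the length of the permutation are the slots y < k + 3.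
  fillings : ℕ → Window → ℕ
  fillings zero    U = 1
  fillings (suc k) U =
    move (fillings k) (3 + k) U 0 + move (fillings k) (3 + k) U 1 + move (fillings k) (3 + k) U (2 + m)

  fillings-cong : ∀ k {U V} → (∀ z → U z ≡ V z) → fillings k U ≡ fillings k V
  fillings-cong zero    U≗V = refl
  fillings-cong (suc k) {U} {V} U≗V = cong₂ _+_ (cong₂ _+_ (move-cong 0) (move-cong 1)) (move-cong (2 + m))
    where
    move-cong : ∀ y → move (fillings k) (3 + k) U y ≡ move (fillings k) (3 + k) V y
    move-cong y = cong₂ (λ b n → if y <ᵇ 3 + k then (if b then 0 else n) else 0)
                        (U≗V y) (fillings-cong k (λ z → cong ((y ≡ᵇ suc z) ∨_) (U≗V (suc z))))

  fillings-pigeonhole : ∀ k {U} → free (2 + k) U < k → fillings k U ≡ 0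
  fillings-pigeonhole (suc k) {U} free<k = cong₂ _+_ (cong₂ _+_ (dead 0) (dead 1)) (dead (2 + m))
    where
    dead : ∀ y → move (fillings k) (3 + k) U y ≡ 0
    dead y with y <ᵇ 3 + k in y<K | U y in Uy
    ... | false | _     = refl
    ... | true  | true  = refl
    ... | true  | false = fillings-pigeonhole k (ℕ.<-≤-trans
      (free-advance (2 + k) {U} {y} Uy (ℕ.<ᵇ⇒< y (3 + k) (subst T (sym y<K) _))) (ℕ.≤-pred free<k))

  -- A move other than to slot 0 drops the free slot 0 from the window, leaving too few free slots.
  fillings-forced : ∀ k U y → U 0 ≡ false → free (3 + k) U ≡ suc k →
                    move (fillings k) (3 + k) U (suc y) ≡ 0
  fillings-forced k U y U0≡false free≡ with suc y <ᵇ 3 + k in y<K | U (suc y) in Uy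
  ... | false | _     = refl
  ... | true  | true  = refl
  ... | true  | false = fillings-pigeonhole k (ℕ.≤-reflexive (ℕ.suc-injective (begin
    suc (suc (free (2 + k) (advance U (suc y))))
      ≡⟨ cong suc (free-occupy (2 + k) {λ z → U (suc z)} {y} Uy
                     (ℕ.≤-pred (ℕ.<ᵇ⇒< (suc y) (3 + k) (subst T (sym y<K) _)))) ⟩
    suc (free (2 + k) (λ z → U (suc z)))
      ≡⟨ cong (λ b → (if b then 0 else 1) + free (2 + k) (λ z → U (suc z))) U0≡false ⟨
    free (3 + k) U
      ≡⟨ free≡ ⟩
    suc k ∎)))
    where open ≡-Reasoning

  fillings-slide : ∀ k {a b} → a ≢ b → suc a < 3 + k → suc b < 3 + k →
                   fillings (suc k) (blocked (suc a) (suc b)) ≡ fillings k (blocked a b)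
  fillings-slide k {a} {b} a≢b a<K b<K =
    trans (cong₂ (λ x y → fillings k (blocked a b) + x + y)
                 (fillings-forced k U 0 refl free≡) (fillings-forced k U (suc m) refl free≡))
          (trans (ℕ.+-identityʳ _) (ℕ.+-identityʳ _))
    where
    U : Window
    U = blocked (suc a) (suc b)
    free≡ : free (3 + k) U ≡ suc k
    free≡ = ℕ.suc-injective (ℕ.suc-injective (free-blocked (3 + k) (a≢b ∘ ℕ.suc-injective) a<K b<K))

  fillings-slideⁿ : ∀ a k c → c ≤ k →
                    fillings (a + k) (blocked a (a + suc c)) ≡ fillings k (blocked 0 (suc c))
  fillings-slideⁿ zero    k c c≤k = refl
  fillings-slideⁿ (suc a) k c c≤k =
    trans (fillings-slide (a + k) (λ a≡ → ℕ.m≢1+m+n a (trans a≡ (ℕ.+-suc a c))) a<K c<K)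
          (fillings-slideⁿ a k c c≤k)
    where
    a<K : suc a < 3 + (a + k)
    a<K = s≤s (s≤s (ℕ.m≤n⇒m≤1+n (ℕ.m≤m+n a k)))
    c<K : suc (a + suc c) < 3 + (a + k)
    c<K = s≤s (s≤s (subst (a + suc c ≤_) (ℕ.+-suc a k) (ℕ.+-monoʳ-≤ a (s≤s c≤k))))

  fillings-suc-01 : ∀ k →
    fillings (suc k) (blocked 0 1) ≡ (if m <ᵇ suc k then fillings k (blocked 0 (suc m)) else 0)
  fillings-suc-01 k = cong (λ n → if m <ᵇ suc k then n else 0) (fillings-cong k (blocked-comm (suc m) 0))

  fillings-suc-0c : ∀ k c → c < m →
    fillings (suc k) (blocked 0 (2 + c))
      ≡ fillings k (blocked 0 (suc c)) + (if m <ᵇ suc k then fillings k (blocked (suc c) (suc m)) else 0)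
  fillings-suc-0c k c c<m = cong (fillings k (blocked 0 (suc c)) +_)
    (cong₂ (λ b n → if m <ᵇ suc k then (if b then 0 else n) else 0)
           (trans (∨-identityʳ _) (≡ᵇ-false (ℕ.<⇒≢ c<m))) (fillings-cong k (blocked-comm (suc m) (suc c))))

module Convolutions where

  open import Data.Integer using (ℤ; +_; _+_; _*_)
  import Data.Integer.Properties as ℤ
  open import Data.Nat using (_<_) renaming (_+_ to _+ℕ_)
  open RangeSums ℤ.+-0-isCommutativeMonoid

  data LessOrOffset (a : ℕ) : ℕ → Set where
    less   : ∀ {n} → n < a → LessOrOffset a n
    offset : ∀ r → LessOrOffset a (a +ℕ r)

  lessOrOffset : ∀ a n → LessOrOffset a n
  lessOrOffset zero    n       = offset n
  lessOrOffset (suc a) zero    = less (s≤s z≤n)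
  lessOrOffset (suc a) (suc n) with lessOrOffset a n
  ... | less n<a = less (s≤s n<a)
  ... | offset r = offset r

  -- Multiplication of the generating function of f by x^a.
  shift : ℕ → (ℕ → ℤ) → ℕ → ℤ
  shift zero    f j       = f j
  shift (suc a) f zero    = + 0
  shift (suc a) f (suc j) = shift a f j

  shift-< : ∀ {a j} f → j < a → shift a f j ≡ + 0
  shift-< {suc a} {zero}  f _         = refl
  shift-< {suc a} {suc j} f (s≤s j<a) = shift-< f j<a

  shift-+ : ∀ a f i → shift a f (a +ℕ i) ≡ f i
  shift-+ zero    f i = refl
  shift-+ (suc a) f i = shift-+ a f i

  infixl 7 _⋆_
  _⋆_ : (ℕ → ℤ) → (ℕ → ℤ) → ℕ → ℤ
  (f ⋆ g) n = ∑< (suc n) (λ j → f j * g (n ∸ j))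

  ⋆-identityˡ : ∀ {e} g → (∀ j → e j ≡ δ j 0) → ∀ n → (e ⋆ g) n ≡ g n
  ⋆-identityˡ {e} g e≗δ n = begin
    e 0 * g n + ∑< n (λ j → e (suc j) * g (n ∸ suc j))
      ≡⟨ cong₂ _+_ (cong (_* g n) (e≗δ 0))
                   (∑<-zero n (λ j _ → cong (_* g (n ∸ suc j)) (e≗δ (suc j)))) ⟩
    + 1 * g n + + 0 ≡⟨ ℤ.+-identityʳ _ ⟩
    + 1 * g n       ≡⟨ ℤ.*-identityˡ (g n) ⟩
    g n             ∎
    where open ≡-Reasoning

  ⋆-distribʳ : ∀ {h} f f′ g → (∀ j → h j ≡ f j + f′ j) →
               ∀ n → (h ⋆ g) n ≡ (f ⋆ g) n + (f′ ⋆ g) n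
  ⋆-distribʳ f f′ g h≗ n =
    trans (∑<-cong (suc n) (λ j _ → trans (cong (_* g (n ∸ j)) (h≗ j))
                                          (ℤ.*-distribʳ-+ (g (n ∸ j)) (f j) (f′ j))))
          (∑<-distrib (suc n) (λ j → f j * g (n ∸ j)) (λ j → f′ j * g (n ∸ j)))

  shift-⋆-< : ∀ a f g {n} → n < a → (shift a f ⋆ g) n ≡ + 0
  shift-⋆-< a f g {n} n<a = ∑<-zero (suc n) (λ j j≤n →
    trans (cong (_* g (n ∸ j)) (shift-< f (ℕ.<-≤-trans j≤n n<a))) (ℤ.*-zeroˡ (g (n ∸ j))))

  shift-⋆-+ : ∀ a f g n → (shift a f ⋆ g) (a +ℕ n) ≡ (f ⋆ g) n
  shift-⋆-+ a f g n = begin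
    ∑< (suc (a +ℕ n)) (λ j → shift a f j * g (a +ℕ n ∸ j))
      ≡⟨ cong (λ l → ∑< l (λ j → shift a f j * g (a +ℕ n ∸ j))) (sym (ℕ.+-suc a n)) ⟩
    ∑< (a +ℕ suc n) (λ j → shift a f j * g (a +ℕ n ∸ j))
      ≡⟨ ∑<-leadingZeros a (suc n) (λ j j<a → trans (cong (_* g (a +ℕ n ∸ j)) (shift-< f j<a))
                                                    (ℤ.*-zeroˡ (g (a +ℕ n ∸ j)))) ⟩
    ∑< (suc n) (λ i → shift a f (a +ℕ i) * g (a +ℕ n ∸ (a +ℕ i)))
      ≡⟨ ∑<-cong (suc n) (λ i _ → cong₂ _*_ (shift-+ a f i) (cong g (ℕ.[m+n]∸[m+o]≡n∸o a n i))) ⟩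
    (f ⋆ g) n ∎
    where open ≡-Reasoning

module Weights (m : ℕ) where

  open Windows
  open Fillings m
  open Convolutions using (shift; shift-<; shift-+; less; offset; lessOrOffset)
  open import Data.Integer using (ℤ; +_; _+_)
  import Data.Integer.Properties as ℤ
  open import Data.Nat using (_≤_; _<_) renaming (_+_ to _+ℕ_)
  open import Data.Nat.Tactic.RingSolver using (solve-∀)

  weight : ℕ → ℕ → ℤ
  weight zero    j = δ j 0
  weight (suc d) j = + fillings (d +ℕ j) (blocked 0 (suc d))

  guarded-shift : ∀ c a j (F : ℕ → ℕ) (G : ℕ → ℤ) → c +ℕ a ≡ m →
                  (∀ i → + F (c +ℕ (a +ℕ i)) ≡ G i) →
                  + (if m <ᵇ suc (c +ℕ j) then F (c +ℕ j) else 0) ≡ shift a G j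
  guarded-shift c a j F G c+a≡m F≗G with lessOrOffset a j
  ... | less j<a rewrite <ᵇ-false (subst (suc (c +ℕ j) ≤_) c+a≡m (ℕ.+-monoʳ-< c j<a)) = sym (shift-< G j<a)
  ... | offset i rewrite <ᵇ-true (s≤s (subst (_≤ c +ℕ (a +ℕ i)) c+a≡m (ℕ.+-monoʳ-≤ c (ℕ.m≤m+n a i)))) =
    trans (F≗G i) (sym (shift-+ a G i))

  weight-suc : ∀ d a → d +ℕ suc a ≡ suc m →
               ∀ j → weight (suc d) j ≡ weight d j + shift (suc a) (weight (suc a)) j
  weight-suc zero    a refl zero    = refl
  weight-suc zero    a refl (suc j) = begin
    + fillings (suc j) (blocked 0 1)
      ≡⟨ cong +_ (fillings-suc-01 j) ⟩
    + (if m <ᵇ suc j then fillings j (blocked 0 (suc m)) else 0)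
      ≡⟨ guarded-shift 0 m j (λ n → fillings n (blocked 0 (suc m))) (weight (suc m)) refl (λ _ → refl) ⟩
    shift m (weight (suc m)) j
      ≡⟨ ℤ.+-identityˡ _ ⟨
    + 0 + shift m (weight (suc m)) j ∎
    where open ≡-Reasoning
  weight-suc (suc c) a c+a≡m j = begin
    + fillings (suc (c +ℕ j)) (blocked 0 (2 +ℕ c))
      ≡⟨ cong +_ (fillings-suc-0c (c +ℕ j) c c<m) ⟩
    + (fillings (c +ℕ j) (blocked 0 (suc c)) +ℕ later (c +ℕ j))
      ≡⟨ ℤ.pos-+ (fillings (c +ℕ j) (blocked 0 (suc c))) _ ⟩
    weight (suc c) j + + later (c +ℕ j)
      ≡⟨ cong (_+_ (weight (suc c) j))
              (guarded-shift c (suc a) j (λ n → fillings n (blocked (suc c) (suc m))) (weight (suc a))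
                             c+a≡m′ slid) ⟩
    weight (suc c) j + shift (suc a) (weight (suc a)) j ∎
    where
    open ≡-Reasoning
    later : ℕ → ℕ
    later k = if m <ᵇ suc k then fillings k (blocked (suc c) (suc m)) else 0
    c+a≡m′ : c +ℕ suc a ≡ m
    c+a≡m′ = ℕ.suc-injective c+a≡m
    c<m : c < m
    c<m = subst (c <_) c+a≡m′ (ℕ.m<m+n c (s≤s z≤n))
    reindex : ∀ c a i → c +ℕ (suc a +ℕ i) ≡ suc c +ℕ (a +ℕ i)
    reindex = solve-∀
    slid : ∀ i → + fillings (c +ℕ (suc a +ℕ i)) (blocked (suc c) (suc m)) ≡ weight (suc a) i
    slid i = cong +_ (begin
      fillings (c +ℕ (suc a +ℕ i)) (blocked (suc c) (suc m))
        ≡⟨ cong₂ (λ k b → fillings k (blocked (suc c) b)) (reindex c a i) (sym c+a≡m) ⟩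
      fillings (suc c +ℕ (a +ℕ i)) (blocked (suc c) (suc c +ℕ suc a))
        ≡⟨ fillings-slideⁿ (suc c) (a +ℕ i) a (ℕ.m≤m+n a i) ⟩
      fillings (a +ℕ i) (blocked 0 (suc a)) ∎)

module Bridge (m : ℕ) where

  open Windows
  open Fillings m
  open Counting
  open RangeSums ℕ.+-0-isCommutativeMonoid
  open import Data.Bool.Properties using (T-∨; ∨-identityʳ; ∧-commutativeMonoid; ∨-∧-booleanAlgebra)
  open import Algebra.Bundles using (CommutativeMonoid)
  open import Algebra.Lattice.Properties.BooleanAlgebra ∨-∧-booleanAlgebra using (deMorgan₂)
  open import Algebra.Properties.CommutativeSemigroup
    (CommutativeMonoid.commutativeSemigroup ∧-commutativeMonoid) using (interchange)
  open import Algebra.Solver.CommutativeMonoid ∧-commutativeMonoid using (solve; _⊜_; _⊕_)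
  open import Data.Empty using (⊥; ⊥-elim)
  open import Data.Fin using (Fin; toℕ)
  import Data.Fin.Properties as Fin
  open import Data.Integer using (ℤ; +_; -_) renaming (_+_ to _+ℤ_; _-_ to _-ℤ_)
  import Data.Integer.Properties as ℤ
  open import Data.Integer.Tactic.RingSolver using (solve-∀)
  open import Data.List using (List; []; _∷_; foldr; allFin; map; concatMap; tabulate)
  import Data.List.Properties as List
  open import Data.Nat using (_+_)
  open import Data.Nat.ListAction using (sum)
  open import Data.Sum using (inj₁; inj₂)
  open import Data.Vec using (Vec; []; _∷_; lookup)
  open import Function using (Equivalence)
  open import Relation.Nullary using (does)
  open import Relation.Nullary.Decidable using (does-≡; map′)

  W : List ℤ
  W = - + 2 ∷ - + 1 ∷ + m ∷ []

  fits : ℕ → ℕ → Bool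
  fits x o = (+ x -ℤ + o) ∈ᵇ W

  arrives : ℕ → ℕ → ℕ → Bool
  arrives o y x = 2 + x ≡ᵇ o + y

  m-n≡o-p⇒m+p≡o+n : ∀ a b c d → a -ℤ b ≡ c -ℤ d → a +ℤ d ≡ c +ℤ b
  m-n≡o-p⇒m+p≡o+n a b c d eq = begin
    a +ℤ d             ≡⟨ regroup a b d ⟩
    a -ℤ b +ℤ (b +ℤ d) ≡⟨ cong (_+ℤ (b +ℤ d)) eq ⟩
    c -ℤ d +ℤ (b +ℤ d) ≡⟨ regroup′ c b d ⟩
    c +ℤ b             ∎
    where
    open ≡-Reasoning
    regroup : ∀ a b d → a +ℤ d ≡ a -ℤ b +ℤ (b +ℤ d)
    regroup = solve-∀
    regroup′ : ∀ c b d → c -ℤ d +ℤ (b +ℤ d) ≡ c +ℤ b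
    regroup′ = solve-∀

  m+p≡o+n⇒m-n≡o-p : ∀ a b c d → a +ℤ d ≡ c +ℤ b → a -ℤ b ≡ c -ℤ d
  m+p≡o+n⇒m-n≡o-p a b c d eq = begin
    a -ℤ b             ≡⟨ regroup a b d ⟩
    a +ℤ d -ℤ (b +ℤ d) ≡⟨ cong (_-ℤ (b +ℤ d)) eq ⟩
    c +ℤ b -ℤ (b +ℤ d) ≡⟨ regroup′ c b d ⟩
    c -ℤ d             ∎
    where
    open ≡-Reasoning
    regroup : ∀ a b d → a -ℤ b ≡ a +ℤ d -ℤ (b +ℤ d)
    regroup = solve-∀
    regroup′ : ∀ c b d → c +ℤ b -ℤ (b +ℤ d) ≡ c -ℤ d
    regroup′ = solve-∀

  does-diff : ∀ x o y → does (+ x -ℤ + o ℤ.≟ + y -ℤ + 2) ≡ arrives o y x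
  does-diff x o y = does-≡ (+ x -ℤ + o ℤ.≟ + y -ℤ + 2) (map′ to from (2 + x ℕ.≟ o + y))
    where
    open ≡-Reasoning
    to : 2 + x ≡ o + y → + x -ℤ + o ≡ + y -ℤ + 2
    to eq = m+p≡o+n⇒m-n≡o-p (+ x) (+ o) (+ y) (+ 2) (begin
      + x +ℤ + 2  ≡⟨ ℤ.pos-+ x 2 ⟨
      + (x + 2)   ≡⟨ cong +_ (trans (ℕ.+-comm x 2) (trans eq (ℕ.+-comm o y))) ⟩
      + (y + o)   ≡⟨ ℤ.pos-+ y o ⟩
      + y +ℤ + o  ∎)
    from : + x -ℤ + o ≡ + y -ℤ + 2 → 2 + x ≡ o + y
    from eq = ℤ.+-injective (begin
      + (2 + x)   ≡⟨ cong +_ (ℕ.+-comm 2 x) ⟩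
      + (x + 2)   ≡⟨ ℤ.pos-+ x 2 ⟩
      + x +ℤ + 2  ≡⟨ m-n≡o-p⇒m+p≡o+n (+ x) (+ o) (+ y) (+ 2) eq ⟩
      + y +ℤ + o  ≡⟨ ℤ.pos-+ y o ⟨
      + (y + o)   ≡⟨ cong +_ (ℕ.+-comm y o) ⟩
      + (o + y)   ∎)

  fits-arrives : ∀ x o → fits x o ≡ arrives o 0 x ∨ (arrives o 1 x ∨ (arrives o (2 + m) x ∨ false))
  fits-arrives x o =
    cong₂ _∨_ (does-diff x o 0) (cong₂ _∨_ (does-diff x o 1) (cong (_∨ false) (does-diff x o (2 + m))))

  allowedFrom : ∀ {n k} → ℕ → Vec (Fin n) k → Bool
  allowedFrom o []       = true
  allowedFrom o (x ∷ xs) = fits (toℕ x) o ∧ allowedFrom (suc o) xs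

  allowedFrom-lookup : ∀ {n k} o (v : Vec (Fin n) k) →
    foldr (λ i b → fits (toℕ (lookup v i)) (o + toℕ i) ∧ b) true (allFin k) ≡ allowedFrom o v
  allowedFrom-lookup o [] = refl
  allowedFrom-lookup {k = suc k} o (x ∷ xs) = cong₂ _∧_ (cong (fits (toℕ x)) (ℕ.+-identityʳ o)) (begin
    foldr (λ i b → fits (toℕ (lookup (x ∷ xs) i)) (o + toℕ i) ∧ b) true (tabulate Fin.suc)
      ≡⟨ cong (foldr (λ i b → fits (toℕ (lookup (x ∷ xs) i)) (o + toℕ i) ∧ b) true)
              (List.map-tabulate {n = k} (λ i → i) Fin.suc) ⟨
    foldr (λ i b → fits (toℕ (lookup (x ∷ xs) i)) (o + toℕ i) ∧ b) true (map Fin.suc (allFin k))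
      ≡⟨ List.foldr-map _ Fin.suc true (allFin k) ⟩
    foldr (λ i b → fits (toℕ (lookup xs i)) (o + suc (toℕ i)) ∧ b) true (allFin k)
      ≡⟨ List.foldr-cong (λ i b → cong (λ p → fits (toℕ (lookup xs i)) p ∧ b) (ℕ.+-suc o (toℕ i)))
                         refl (allFin k) ⟩
    foldr (λ i b → fits (toℕ (lookup xs i)) (suc o + toℕ i) ∧ b) true (allFin k)
      ≡⟨ allowedFrom-lookup (suc o) xs ⟩
    allowedFrom (suc o) xs ∎)
    where open ≡-Reasoning

  allowed≡allowedFrom : ∀ {n} (π : Vec (Fin n) n) → allowed W π ≡ allowedFrom 0 π
  allowed≡allowedFrom = allowedFrom-lookup 0

  -- The set A of used values is stored shifted by two (value x is A (2 + x)), so that the window at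
  -- position o is A (o + _) and the values −2 and −1 are the slots 0 and 1 of the first window.
  avoids : ∀ {n k} → (ℕ → Bool) → Vec (Fin n) k → Bool
  avoids A []       = true
  avoids A (x ∷ xs) = not (A (2 + toℕ x)) ∧ avoids A xs

  valid : ∀ {n k} → (ℕ → Bool) → ℕ → Vec (Fin n) k → Bool
  valid A o []       = true
  valid A o (x ∷ xs) = (not (A (2 + toℕ x)) ∧ fits (toℕ x) o) ∧ valid (occupy (2 + toℕ x) A) (suc o) xs

  window : (ℕ → Bool) → ℕ → Window
  window A o y = A (o + y)

  does-Fin≟ : ∀ {n} (x y : Fin n) → does (x Fin.≟ y) ≡ (toℕ x ≡ᵇ toℕ y)
  does-Fin≟ x y = does-≡ (x Fin.≟ y) (map′ Fin.toℕ-injective (cong toℕ) (toℕ x ℕ.≟ toℕ y))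

  avoids-occupy : ∀ {n k} (x : Fin n) (xs : Vec (Fin n) k) A →
                  notIn x xs ∧ avoids A xs ≡ avoids (occupy (2 + toℕ x) A) xs
  avoids-occupy x []       A = refl
  avoids-occupy x (y ∷ ys) A = begin
    (not (does (x Fin.≟ y)) ∧ notIn x ys) ∧ (not (A (2 + toℕ y)) ∧ avoids A ys)
      ≡⟨ interchange (not (does (x Fin.≟ y))) (notIn x ys) (not (A (2 + toℕ y))) (avoids A ys) ⟩
    (not (does (x Fin.≟ y)) ∧ not (A (2 + toℕ y))) ∧ (notIn x ys ∧ avoids A ys)
      ≡⟨ cong₂ _∧_ (trans (cong (λ b → not b ∧ not (A (2 + toℕ y))) (does-Fin≟ x y))
                          (sym (deMorgan₂ (toℕ x ≡ᵇ toℕ y) (A (2 + toℕ y)))))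
                   (avoids-occupy x ys A) ⟩
    not ((toℕ x ≡ᵇ toℕ y) ∨ A (2 + toℕ y)) ∧ avoids (occupy (2 + toℕ x) A) ys ∎
    where open ≡-Reasoning

  valid-spec : ∀ {n k} A o (v : Vec (Fin n) k) → valid A o v ≡ avoids A v ∧ (distinct v ∧ allowedFrom o v)
  valid-spec A o []       = refl
  valid-spec A o (x ∷ xs) = begin
    (a ∧ f) ∧ valid (occupy (2 + toℕ x) A) (suc o) xs
      ≡⟨ cong ((a ∧ f) ∧_) (trans (valid-spec _ (suc o) xs)
                                  (cong (_∧ (distinct xs ∧ allowedFrom (suc o) xs)) (sym (avoids-occupy x xs A)))) ⟩
    (a ∧ f) ∧ ((notIn x xs ∧ avoids A xs) ∧ (distinct xs ∧ allowedFrom (suc o) xs))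
      ≡⟨ rearrange a f (notIn x xs) (avoids A xs) (distinct xs) (allowedFrom (suc o) xs) ⟩
    (a ∧ avoids A xs) ∧ ((notIn x xs ∧ distinct xs) ∧ (f ∧ allowedFrom (suc o) xs)) ∎
    where
    open ≡-Reasoning
    a f : Bool
    a = not (A (2 + toℕ x))
    f = fits (toℕ x) o
    rearrange : ∀ a f ni av d al →
                (a ∧ f) ∧ ((ni ∧ av) ∧ (d ∧ al)) ≡ (a ∧ av) ∧ ((ni ∧ d) ∧ (f ∧ al))
    rearrange = solve 6 (λ a f ni av d al →
                  (a ⊕ f) ⊕ ((ni ⊕ av) ⊕ (d ⊕ al)) ⊜ (a ⊕ av) ⊕ ((ni ⊕ d) ⊕ (f ⊕ al))) refl

  avoids-blocked : ∀ {n k} (v : Vec (Fin n) k) → avoids (blocked 0 1) v ≡ true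
  avoids-blocked []       = refl
  avoids-blocked (x ∷ xs) = avoids-blocked xs

  extensions : ℕ → ℕ → (ℕ → Bool) → ℕ → ℕ
  extensions n k A o = count (valid A o) (allVecs k n)

  P≡extensions : ∀ n → P n W ≡ extensions n n (blocked 0 1) 0
  P≡extensions n = count-cong (λ π → sym (begin
    valid (blocked 0 1) 0 π                                 ≡⟨ valid-spec (blocked 0 1) 0 π ⟩
    avoids (blocked 0 1) π ∧ (distinct π ∧ allowedFrom 0 π) ≡⟨ cong₂ (λ b c → b ∧ (distinct π ∧ c))
                                                                    (avoids-blocked π) (sym (allowed≡allowedFrom π)) ⟩
    distinct π ∧ allowed W π                                ∎)) (allVecs n n)
    where open ≡-Reasoning

  extensions-suc : ∀ n k A o → extensions n (suc k) A o
    ≡ ∑< n (λ x → if not (A (2 + x)) ∧ fits x o then extensions n k (occupy (2 + x) A) (suc o) else 0)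
  extensions-suc n k A o = begin
    count (valid A o) (concatMap (λ x → map (x ∷_) (allVecs k n)) (allFin n))
      ≡⟨ count-concatMap (valid A o) (λ x → map (x ∷_) (allVecs k n)) (allFin n) ⟩
    sum (map (λ x → count (valid A o) (map (x ∷_) (allVecs k n))) (allFin n))
      ≡⟨ cong sum (List.map-cong (λ x → trans (count-map (valid A o) (x ∷_) (allVecs k n))
                                              (count-guard _ _ (allVecs k n))) (allFin n)) ⟩
    sum (map (λ x → h (toℕ x)) (allFin n))
      ≡⟨ cong sum (List.map-tabulate {n = n} (λ i → i) (λ x → h (toℕ x))) ⟩
    sum (tabulate {n = n} (λ x → h (toℕ x)))
      ≡⟨ sum-tabulate n h ⟩
    ∑< n h ∎
    where
    open ≡-Reasoning
    h : ℕ → ℕ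
    h x = if not (A (2 + x)) ∧ fits x o then extensions n k (occupy (2 + x) A) (suc o) else 0

  if-∨ : ∀ p q n → (T p → T q → ⊥) →
         (if p ∨ q then n else 0) ≡ (if p then n else 0) + (if q then n else 0)
  if-∨ true  true  n p∧q = ⊥-elim (p∧q _ _)
  if-∨ true  false n _   = sym (ℕ.+-identityʳ n)
  if-∨ false q     n _   = refl

  if-not-∧ : ∀ a b n → (if not a ∧ b then n else 0) ≡ (if b then (if a then 0 else n) else 0)
  if-not-∧ true  true  n = refl
  if-not-∧ true  false n = refl
  if-not-∧ false b     n = refl

  if-0 : ∀ b → (if b then 0 else 0) ≡ 0
  if-0 true  = refl
  if-0 false = refl

  arrives-injective : ∀ {o y y′ x} → T (arrives o y x) → T (arrives o y′ x) → y ≡ y′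
  arrives-injective {o} {y} {y′} {x} t t′ =
    ℕ.+-cancelˡ-≡ o y y′ (trans (sym (ℕ.≡ᵇ⇒≡ (2 + x) (o + y) t)) (ℕ.≡ᵇ⇒≡ (2 + x) (o + y′) t′))

  fits-split : ∀ a x o n → (if not a ∧ fits x o then n else 0)
    ≡ (if arrives o 0 x then (if a then 0 else n) else 0)
      + ((if arrives o 1 x then (if a then 0 else n) else 0) + (if arrives o (2 + m) x then (if a then 0 else n) else 0))
  fits-split a x o n = begin
    (if not a ∧ fits x o then n else 0)
      ≡⟨ cong (λ b → if not a ∧ b then n else 0) (fits-arrives x o) ⟩
    (if not a ∧ (arrives o 0 x ∨ (arrives o 1 x ∨ (arrives o (2 + m) x ∨ false))) then n else 0)
      ≡⟨ if-not-∧ a _ n ⟩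
    (if arrives o 0 x ∨ (arrives o 1 x ∨ (arrives o (2 + m) x ∨ false)) then h else 0)
      ≡⟨ if-∨ (arrives o 0 x) _ h excl₀ ⟩
    g 0 + (if arrives o 1 x ∨ (arrives o (2 + m) x ∨ false) then h else 0)
      ≡⟨ cong (λ z → g 0 + z) (if-∨ (arrives o 1 x) _ h excl₁) ⟩
    g 0 + (g 1 + (if arrives o (2 + m) x ∨ false then h else 0))
      ≡⟨ cong (λ b → g 0 + (g 1 + (if b then h else 0))) (∨-identityʳ (arrives o (2 + m) x)) ⟩
    g 0 + (g 1 + g (2 + m)) ∎
    where
    open ≡-Reasoning
    h : ℕ
    h = if a then 0 else n
    g : ℕ → ℕ
    g y = if arrives o y x then h else 0
    excl₀ : T (arrives o 0 x) → T (arrives o 1 x ∨ (arrives o (2 + m) x ∨ false)) → ⊥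
    excl₀ t t′ with Equivalence.to T-∨ t′
    ... | inj₁ t₁ with () ← arrives-injective {o} {0} {1} {x} t t₁
    ... | inj₂ t₂ with Equivalence.to T-∨ t₂
    ...   | inj₁ t₃ with () ← arrives-injective {o} {0} {2 + m} {x} t t₃
    excl₁ : T (arrives o 1 x) → T (arrives o (2 + m) x ∨ false) → ⊥
    excl₁ t t′ with Equivalence.to T-∨ t′
    ... | inj₁ t₃ with () ← arrives-injective {o} {1} {2 + m} {x} t t₃

  +-≡ᵇ-cancelˡ : ∀ o a b → (o + a ≡ᵇ o + b) ≡ (a ≡ᵇ b)
  +-≡ᵇ-cancelˡ zero    a b = refl
  +-≡ᵇ-cancelˡ (suc o) a b = +-≡ᵇ-cancelˡ o a b

  +-<ᵇ-cancelˡ : ∀ o a b → (o + a <ᵇ o + b) ≡ (a <ᵇ b)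
  +-<ᵇ-cancelˡ zero    a b = refl
  +-<ᵇ-cancelˡ (suc o) a b = +-<ᵇ-cancelˡ o a b

  arrival-move : ∀ k A o y v → A 0 ≡ true → A 1 ≡ true → o + y ≡ v →
    ∑< (o + suc k) (λ x → if 2 + x ≡ᵇ v
                            then (if A (2 + x) then 0 else fillings k (window (occupy (2 + x) A) (suc o)))
                            else 0)
      ≡ (if y <ᵇ 3 + k then (if A v then 0 else fillings k (advance (window A o) y)) else 0)
  arrival-move k A o y zero A0 _ _ rewrite A0 = trans (∑<-zero (o + suc k) (λ _ _ → refl)) (sym (if-0 (y <ᵇ 3 + k)))
  arrival-move k A o y 1    _ A1 _ rewrite A1 = trans (∑<-zero (o + suc k) (λ _ _ → refl)) (sym (if-0 (y <ᵇ 3 + k)))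
  arrival-move k A o y (suc (suc c)) _ _ o+y≡ = trans (∑<-point (o + suc k) c _)
    (cong₂ (λ b n → if b then (if A (2 + c) then 0 else n) else 0) in-range (fillings-cong k landing))
    where
    open ≡-Reasoning
    in-range : (c <ᵇ o + suc k) ≡ (y <ᵇ 3 + k)
    in-range = begin
      (2 + c <ᵇ 2 + (o + suc k)) ≡⟨ cong₂ _<ᵇ_ (sym o+y≡) (trans (ℕ.+-comm 2 (o + suc k))
                                      (trans (ℕ.+-assoc o (suc k) 2) (cong (λ n → o + n) (ℕ.+-comm (suc k) 2)))) ⟩
      (o + y <ᵇ o + (3 + k))     ≡⟨ +-<ᵇ-cancelˡ o y (3 + k) ⟩
      (y <ᵇ 3 + k)               ∎
    landing : ∀ z → window (occupy (2 + c) A) (suc o) z ≡ advance (window A o) y z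
    landing z = cong₂ _∨_ taken (cong A (sym (ℕ.+-suc o z)))
      where
      taken : (2 + c ≡ᵇ suc (o + z)) ≡ (y ≡ᵇ suc z)
      taken = trans (cong₂ _≡ᵇ_ (sym o+y≡) (sym (ℕ.+-suc o z))) (+-≡ᵇ-cancelˡ o y (suc z))

  extensions≡fillings : ∀ k n A o → A 0 ≡ true → A 1 ≡ true → o + k ≡ n →
                        extensions n k A o ≡ fillings k (window A o)
  extensions≡fillings zero    n A o _  _  _    = refl
  extensions≡fillings (suc k) _ A o A0 A1 refl = begin
    extensions n (suc k) A o
      ≡⟨ extensions-suc n k A o ⟩
    ∑< n (λ x → if not (A (2 + x)) ∧ fits x o then extensions n k (occupy (2 + x) A) (suc o) else 0)
      ≡⟨ ∑<-cong n (λ x _ → cong (λ e → if not (A (2 + x)) ∧ fits x o then e else 0)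
           (extensions≡fillings k n (occupy (2 + x) A) (suc o) A0 A1 (sym (ℕ.+-suc o k)))) ⟩
    ∑< n (λ x → if not (A (2 + x)) ∧ fits x o then F x else 0)
      ≡⟨ ∑<-cong n (λ x _ → fits-split (A (2 + x)) x o (F x)) ⟩
    ∑< n (λ x → g 0 x + (g 1 x + g (2 + m) x))
      ≡⟨ ∑<-distrib n (g 0) (λ x → g 1 x + g (2 + m) x) ⟩
    ∑< n (g 0) + ∑< n (λ x → g 1 x + g (2 + m) x)
      ≡⟨ cong (λ z → ∑< n (g 0) + z) (∑<-distrib n (g 1) (g (2 + m))) ⟩
    ∑< n (g 0) + (∑< n (g 1) + ∑< n (g (2 + m)))
      ≡⟨ cong₂ _+_ (moved 0) (cong₂ _+_ (moved 1) (moved (2 + m))) ⟩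
    move (fillings k) (3 + k) U 0 + (move (fillings k) (3 + k) U 1 + move (fillings k) (3 + k) U (2 + m))
      ≡⟨ ℕ.+-assoc (move (fillings k) (3 + k) U 0) _ _ ⟨
    fillings (suc k) U ∎
    where
    open ≡-Reasoning
    n : ℕ
    n = o + suc k
    U : Window
    U = window A o
    F : ℕ → ℕ
    F x = fillings k (window (occupy (2 + x) A) (suc o))
    g : ℕ → ℕ → ℕ
    g y x = if arrives o y x then (if A (2 + x) then 0 else F x) else 0
    moved : ∀ y → ∑< n (g y) ≡ move (fillings k) (3 + k) U y
    moved y = arrival-move k A o y (o + y) A0 A1 refl

  P≡fillings : ∀ n → P n W ≡ fillings n (blocked 0 1)
  P≡fillings n = trans (P≡extensions n) (extensions≡fillings n n (blocked 0 1) 0 refl refl refl)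

open import Data.Integer using (ℤ; +_; _+_; _*_) renaming (_<_ to _<ℤ_)
open import Data.Nat using () renaming (_+_ to _+ℕ_)

module SquareRecurrence (m : ℕ) (s : ℤ → ℤ)
  (s-neg : ∀ (k : ℤ) → k <ℤ + 0 → s k ≡ + 0)
  (s-rec : ∀ (n : ℕ) → s (+ n) ≡ δ n 0 + s (n ⊖ℕ 1) + s (n ⊖ℕ (m +ℕ 2))) where

  open Convolutions
  open import Data.Integer using (-<+)
  import Data.Integer.Properties as ℤ
  open import Data.Nat using (_≤_; _<_)
  open RangeSums ℤ.+-0-isCommutativeMonoid
  open Weights m using (weight; weight-suc)
  open Bridge m using (W; P≡fillings)
  open import Data.List using (foldr; applyUpTo)
  open import Data.Nat.Induction using (<-rec)
  open import Data.Nat.Tactic.RingSolver using (solve-∀)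
  open import Function using (id)

  t : ℕ → ℤ
  t n = s (+ n)

  t² : ℕ → ℤ
  t² n = t n * t n

  s-⊖ℕ-< : ∀ {n k} → n < k → s (n ⊖ℕ k) ≡ + 0
  s-⊖ℕ-< {n} {k} n<k with k ∸ n | ℕ.m<n⇒0<n∸m n<k | ℤ.⊖-< n<k
  ... | suc j | _ | n⊖k≡ = s-neg _ (subst (_<ℤ + 0) (sym (trans (ℤ.m-n≡m⊖n n k) n⊖k≡)) -<+)

  s-⊖ℕ-+ : ∀ k r → s ((k +ℕ r) ⊖ℕ k) ≡ t r
  s-⊖ℕ-+ k r = cong s (trans (ℤ.m-n≡m⊖n (k +ℕ r) k)
                             (trans (ℤ.⊖-≥ (ℕ.m≤m+n k r)) (cong +_ (ℕ.m+n∸m≡n k r))))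

  t-suc : ∀ n → t (suc n) ≡ t n + s (suc n ⊖ℕ (m +ℕ 2))
  t-suc n = trans (s-rec (suc n)) (cong (_+ s (suc n ⊖ℕ (m +ℕ 2))) (trans (ℤ.+-identityˡ _) (s-⊖ℕ-+ 1 n)))

  m+2≡1+a+1+d : ∀ {d a} → d +ℕ suc a ≡ suc m → m +ℕ 2 ≡ suc a +ℕ suc d
  m+2≡1+a+1+d {d} {a} d+a≡m = begin
    m +ℕ 2           ≡⟨ ℕ.+-comm m 2 ⟩
    suc (suc m)      ≡⟨ cong suc d+a≡m ⟨
    suc (d +ℕ suc a) ≡⟨ cong suc (ℕ.+-comm d (suc a)) ⟩
    suc (suc a +ℕ d) ≡⟨ ℕ.+-suc (suc a) d ⟨
    suc a +ℕ suc d   ∎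
    where open ≡-Reasoning

  module _ (w : ℕ → ℕ → ℤ)
    (w-zero : ∀ j → w 0 j ≡ δ j 0)
    (w-suc : ∀ d a → d +ℕ suc a ≡ suc m → ∀ j → w (suc d) j ≡ w d j + shift (suc a) (w (suc a)) j)
    where

    ProductIdentity : ℕ → Set
    ProductIdentity R = ∀ d → d ≤ suc m → t (R +ℕ d) * t R ≡ (w d ⋆ t²) R

    lagged-product : ∀ R d a → d +ℕ suc a ≡ suc m → (∀ {r} → r < R → ProductIdentity r) →
                     s (suc (R +ℕ d) ⊖ℕ (m +ℕ 2)) * t R ≡ (shift (suc a) (w (suc a)) ⋆ t²) R
    lagged-product R d a d+a≡m ih with lessOrOffset (suc a) R
    ... | less R<a = begin
      s (suc (R +ℕ d) ⊖ℕ (m +ℕ 2)) * t R ≡⟨ cong (_* t R) (s-⊖ℕ-< R+d<m+2) ⟩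
      + 0 * t R                          ≡⟨ ℤ.*-zeroˡ (t R) ⟩
      + 0                                ≡⟨ shift-⋆-< (suc a) (w (suc a)) t² R<a ⟨
      (shift (suc a) (w (suc a)) ⋆ t²) R ∎
      where
      open ≡-Reasoning
      R+d<m+2 : suc (R +ℕ d) < m +ℕ 2
      R+d<m+2 = subst₂ _<_ (ℕ.+-suc R d) (sym (m+2≡1+a+1+d d+a≡m)) (ℕ.+-monoˡ-< (suc d) R<a)
    ... | offset r = begin
      s (suc (suc a +ℕ r +ℕ d) ⊖ℕ (m +ℕ 2)) * t (suc a +ℕ r)
        ≡⟨ cong (λ n → s (n ⊖ℕ (m +ℕ 2)) * t (suc a +ℕ r)) index ⟩
      s ((m +ℕ 2 +ℕ r) ⊖ℕ (m +ℕ 2)) * t (suc a +ℕ r)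
        ≡⟨ cong (_* t (suc a +ℕ r)) (s-⊖ℕ-+ (m +ℕ 2) r) ⟩
      t r * t (suc a +ℕ r)
        ≡⟨ ℤ.*-comm (t r) _ ⟩
      t (suc a +ℕ r) * t r
        ≡⟨ cong (λ n → t n * t r) (ℕ.+-comm (suc a) r) ⟩
      t (r +ℕ suc a) * t r
        ≡⟨ ih (ℕ.m<n+m r (s≤s z≤n)) (suc a) (subst (suc a ≤_) d+a≡m (ℕ.m≤n+m (suc a) d)) ⟩
      (w (suc a) ⋆ t²) r
        ≡⟨ shift-⋆-+ (suc a) (w (suc a)) t² r ⟨
      (shift (suc a) (w (suc a)) ⋆ t²) (suc a +ℕ r) ∎
      where
      open ≡-Reasoning
      rearrange : ∀ a d r → suc (suc a +ℕ r +ℕ d) ≡ suc a +ℕ suc d +ℕ r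
      rearrange = solve-∀
      index : suc (suc a +ℕ r +ℕ d) ≡ m +ℕ 2 +ℕ r
      index = trans (rearrange a d r) (cong (_+ℕ r) (sym (m+2≡1+a+1+d d+a≡m)))

    product-convolution : ∀ R → ProductIdentity R
    product-convolution = <-rec ProductIdentity step
      where
      step : ∀ R → (∀ {r} → r < R → ProductIdentity r) → ProductIdentity R
      step R ih zero _ = begin
        t (R +ℕ 0) * t R ≡⟨ cong (λ n → t n * t R) (ℕ.+-identityʳ R) ⟩
        t² R             ≡⟨ ⋆-identityˡ t² w-zero R ⟨
        (w 0 ⋆ t²) R     ∎
        where open ≡-Reasoning
      step R ih (suc d) (s≤s d≤m) = begin
        t (R +ℕ suc d) * t R
          ≡⟨ cong (λ n → t n * t R) (ℕ.+-suc R d) ⟩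
        t (suc (R +ℕ d)) * t R
          ≡⟨ cong (_* t R) (t-suc (R +ℕ d)) ⟩
        (t (R +ℕ d) + s (suc (R +ℕ d) ⊖ℕ (m +ℕ 2))) * t R
          ≡⟨ ℤ.*-distribʳ-+ (t R) (t (R +ℕ d)) _ ⟩
        t (R +ℕ d) * t R + s (suc (R +ℕ d) ⊖ℕ (m +ℕ 2)) * t R
          ≡⟨ cong₂ _+_ (step R ih d (ℕ.m≤n⇒m≤1+n d≤m)) (lagged-product R d a d+a≡m ih) ⟩
        (w d ⋆ t²) R + (shift (suc a) (w (suc a)) ⋆ t²) R
          ≡⟨ ⋆-distribʳ (w d) (shift (suc a) (w (suc a))) t² (w-suc d a d+a≡m) R ⟨
        (w (suc d) ⋆ t²) R ∎
        where
        open ≡-Reasoning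
        a : ℕ
        a = m ∸ d
        d+a≡m : d +ℕ suc a ≡ suc m
        d+a≡m = trans (ℕ.+-suc d a) (cong suc (ℕ.m+[n∸m]≡n d≤m))

  foldr-applyUpTo : ∀ L (g : ℕ → ℤ) (h : ℕ → ℕ) →
                    foldr (λ i acc → g i + acc) (+ 0) (applyUpTo h L) ≡ ∑< L (λ i → g (h i))
  foldr-applyUpTo zero    g h = refl
  foldr-applyUpTo (suc L) g h = cong (_+_ (g (h 0))) (foldr-applyUpTo L g (λ i → h (suc i)))

  sumFromTo-∑< : ∀ a b f → sumFromTo a b f ≡ ∑< (suc b ∸ a) (λ i → f (a +ℕ i))
  sumFromTo-∑< a b f = foldr-applyUpTo (suc b ∸ a) (λ i → f (a +ℕ i)) id

  P≡weight : ∀ i → + P (suc m +ℕ i) W ≡ weight (suc m) i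
  P≡weight i = begin
    + P (suc m +ℕ i) W                                            ≡⟨ cong +_ (P≡fillings (suc m +ℕ i)) ⟩
    weight 1 (suc m +ℕ i)                                         ≡⟨ weight-suc 0 m refl (suc m +ℕ i) ⟩
    + 0 + shift (suc m) (weight (suc m)) (suc m +ℕ i)             ≡⟨ ℤ.+-identityˡ _ ⟩
    shift (suc m) (weight (suc m)) (suc m +ℕ i)                   ≡⟨ shift-+ (suc m) (weight (suc m)) i ⟩
    weight (suc m) i                                              ∎
    where open ≡-Reasoning

  summand : ℕ → ℕ → ℤ
  summand n l = + P (l ∸ 1) W * (s (n ⊖ℕ l) * s (n ⊖ℕ l))

  cross-term : ∀ n → t n * s (suc n ⊖ℕ (m +ℕ 2)) ≡ sumFromTo (m +ℕ 2) (suc n) (summand (suc n))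
  cross-term n with lessOrOffset (suc m) n
  ... | less n<1+m = begin
    t n * s (suc n ⊖ℕ (m +ℕ 2))
      ≡⟨ cong (t n *_) (s-⊖ℕ-< n+1<m+2) ⟩
    t n * + 0
      ≡⟨ ℤ.*-zeroʳ (t n) ⟩
    + 0
      ≡⟨ cong (λ L → ∑< L (λ i → summand (suc n) (m +ℕ 2 +ℕ i))) (ℕ.m≤n⇒m∸n≡0 n+1<m+2) ⟨
    ∑< (suc (suc n) ∸ (m +ℕ 2)) (λ i → summand (suc n) (m +ℕ 2 +ℕ i))
      ≡⟨ sumFromTo-∑< (m +ℕ 2) (suc n) (summand (suc n)) ⟨
    sumFromTo (m +ℕ 2) (suc n) (summand (suc n)) ∎
    where
    open ≡-Reasoning
    n+1<m+2 : suc n < m +ℕ 2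
    n+1<m+2 = subst (suc n <_) (sym (ℕ.+-comm m 2)) (s≤s n<1+m)
  ... | offset R = begin
    t N * s (suc N ⊖ℕ (m +ℕ 2))
      ≡⟨ cong (λ k → t N * s (k ⊖ℕ (m +ℕ 2))) index ⟩
    t N * s ((m +ℕ 2 +ℕ R) ⊖ℕ (m +ℕ 2))
      ≡⟨ cong (t N *_) (s-⊖ℕ-+ (m +ℕ 2) R) ⟩
    t N * t R
      ≡⟨ cong (λ k → t k * t R) (ℕ.+-comm (suc m) R) ⟩
    t (R +ℕ suc m) * t R
      ≡⟨ product-convolution weight (λ _ → refl) weight-suc R (suc m) ℕ.≤-refl ⟩
    (weight (suc m) ⋆ t²) R
      ≡⟨ ∑<-cong (suc R) term ⟩
    ∑< (suc R) (λ i → f (m +ℕ 2 +ℕ i))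
      ≡⟨ cong (λ L → ∑< L (λ i → f (m +ℕ 2 +ℕ i))) length ⟨
    ∑< (suc (suc N) ∸ (m +ℕ 2)) (λ i → f (m +ℕ 2 +ℕ i))
      ≡⟨ sumFromTo-∑< (m +ℕ 2) (suc N) f ⟨
    sumFromTo (m +ℕ 2) (suc N) f ∎
    where
    open ≡-Reasoning
    N : ℕ
    N = suc m +ℕ R
    f : ℕ → ℤ
    f = summand (suc N)
    shuffle : ∀ m R → suc (suc m +ℕ R) ≡ m +ℕ 2 +ℕ R
    shuffle = solve-∀
    index : suc N ≡ m +ℕ 2 +ℕ R
    index = shuffle m R
    length : suc (suc N) ∸ (m +ℕ 2) ≡ suc R
    length = trans (cong (_∸ (m +ℕ 2)) (trans (cong suc index) (sym (ℕ.+-suc (m +ℕ 2) R))))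
                   (ℕ.m+n∸m≡n (m +ℕ 2) (suc R))
    term : ∀ i → i < suc R → weight (suc m) i * t² (R ∸ i) ≡ f (m +ℕ 2 +ℕ i)
    term i (s≤s i≤R) = cong₂ _*_ coefficient (cong (λ x → x * x) (sym value))
      where
      coefficient : weight (suc m) i ≡ + P (m +ℕ 2 +ℕ i ∸ 1) W
      coefficient = trans (sym (P≡weight i)) (cong (λ k → + P (k ∸ 1) W) (shuffle m i))
      split : suc N ≡ m +ℕ 2 +ℕ i +ℕ (R ∸ i)
      split = trans index (trans (cong (m +ℕ 2 +ℕ_) (sym (ℕ.m+[n∸m]≡n i≤R)))
                                 (sym (ℕ.+-assoc (m +ℕ 2) i (R ∸ i))))
      value : s (suc N ⊖ℕ (m +ℕ 2 +ℕ i)) ≡ t (R ∸ i)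
      value = trans (cong (λ k → s (k ⊖ℕ (m +ℕ 2 +ℕ i))) split) (s-⊖ℕ-+ (m +ℕ 2 +ℕ i) (R ∸ i))

  identity-at-0 : ∀ f → t 0 * t 0 ≡ δ 0 0 + s (0 ⊖ℕ 1) * s (0 ⊖ℕ 1) + s (0 ⊖ℕ (m +ℕ 2)) * s (0 ⊖ℕ (m +ℕ 2))
                                   + + 2 * sumFromTo (m +ℕ 2) 0 f
  identity-at-0 f = begin
    t 0 * t 0
      ≡⟨ cong₂ _*_ t0≡1 t0≡1 ⟩
    + 1
      ≡⟨ cong (λ z → δ 0 0 + + 0 * + 0 + + 0 * + 0 + + 2 * z) empty ⟨
    δ 0 0 + + 0 * + 0 + + 0 * + 0 + + 2 * sumFromTo (m +ℕ 2) 0 f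
      ≡⟨ cong₂ (λ x y → δ 0 0 + x * x + y * y + + 2 * sumFromTo (m +ℕ 2) 0 f) before₀ before₁ ⟩
    δ 0 0 + s (0 ⊖ℕ 1) * s (0 ⊖ℕ 1) + s (0 ⊖ℕ (m +ℕ 2)) * s (0 ⊖ℕ (m +ℕ 2)) + + 2 * sumFromTo (m +ℕ 2) 0 f ∎
    where
    open ≡-Reasoning
    0<m+2 : 0 < m +ℕ 2
    0<m+2 = subst (0 <_) (sym (ℕ.+-comm m 2)) (s≤s z≤n)
    before₀ : + 0 ≡ s (0 ⊖ℕ 1)
    before₀ = sym (s-⊖ℕ-< (s≤s z≤n))
    before₁ : + 0 ≡ s (0 ⊖ℕ (m +ℕ 2))
    before₁ = sym (s-⊖ℕ-< 0<m+2)
    t0≡1 : t 0 ≡ + 1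
    t0≡1 = trans (s-rec 0) (cong₂ (λ x y → δ 0 0 + x + y) (sym before₀) (sym before₁))
    empty : sumFromTo (m +ℕ 2) 0 f ≡ + 0
    empty = trans (sumFromTo-∑< (m +ℕ 2) 0 f)
                  (cong (λ L → ∑< L (λ i → f (m +ℕ 2 +ℕ i))) (ℕ.m≤n⇒m∸n≡0 0<m+2))

open import Data.Integer using (-_; _<_)
open import Data.List using (_∷_; [])

mainTheorem5 : (m : ℕ) (s : ℤ → ℤ)
    → (∀ (k : ℤ) → k < + 0 → s k ≡ + 0)
    → (∀ (n : ℕ) → s (+ n) ≡ δ n 0 + s (n ⊖ℕ 1) + s (n ⊖ℕ (m +ℕ 2)))
    → ∀ (n : ℕ) → s (+ n) * s (+ n)
        ≡ δ n 0 + s (n ⊖ℕ 1) * s (n ⊖ℕ 1) + s (n ⊖ℕ (m +ℕ 2)) * s (n ⊖ℕ (m +ℕ 2))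
          + + 2 * sumFromTo (m +ℕ 2) n (λ l → + P (l ∸ 1) (- + 2 ∷ - + 1 ∷ + m ∷ []) * (s (n ⊖ℕ l) * s (n ⊖ℕ l)))
mainTheorem5 m s s-neg s-rec zero    = identity-at-0 (summand 0)
  where open SquareRecurrence m s s-neg s-rec
mainTheorem5 m s s-neg s-rec (suc n) = begin
  t (suc n) * t (suc n)
    ≡⟨ cong (λ x → x * x) (t-suc n) ⟩
  (t n + lagged) * (t n + lagged)
    ≡⟨ square-expansion (t n) lagged ⟩
  + 0 + t n * t n + lagged * lagged + + 2 * (t n * lagged)
    ≡⟨ cong₂ (λ x y → + 0 + x * x + lagged * lagged + + 2 * y) (sym (s-⊖ℕ-+ 1 n)) (cross-term n) ⟩
  δ (suc n) 0 + s (suc n ⊖ℕ 1) * s (suc n ⊖ℕ 1) + lagged * lagged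
    + + 2 * sumFromTo (m +ℕ 2) (suc n) (summand (suc n)) ∎
  where
  open SquareRecurrence m s s-neg s-rec
  open ≡-Reasoning
  open import Data.Integer.Tactic.RingSolver using (solve-∀)
  lagged : ℤ
  lagged = s (suc n ⊖ℕ (m +ℕ 2))
  square-expansion : ∀ a b → (a + b) * (a + b) ≡ + 0 + a * a + b * b + + 2 * (a * b)
  square-expansion = solve-∀
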